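{- $\chi_{\rho}(G(\mathbb{Z},\{1,2\}))=8$.
   Context: For a graph $G$, a packing $k$-coloring is a map $f:V(G)\to\{1,\ldots,k\}$ such that any two distinct vertices $u,v$ with $f(u)=f(v)=i$ satisfy $d_G(u,v)\geq i+1$. The packing chromatic number $\chi_{\rho}(G)$ is the least $k$ for which a packing $k$-coloring exists. For a set $D$ of positive integers, the distance graph $G(\mathbb{Z},D)$ has vertex set $\mathbb{Z}$, two distinct integers $i,j$ being adjacent iff $|i-j|\in D$. -}

module Defs where

open import Data.Nat using (ℕ; zero; suc; _≤_; _<_)
open import Data.Integer using (ℤ; ∣_∣; _-_)
open import Data.Product using (Σ; _×_)
open import Data.Sum using (_⊎_)
open import Relation.Binary.PropositionalEquality using (_≡_)
open import Relation.Nullary using (¬_)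

record Graph : Set₁ where
  field
    V   : Set
    Adj : V → V → Set
open Graph public

DistanceGraph : (ℕ → Set) → Graph
DistanceGraph D = record { V = ℤ ; Adj = λ i j → ¬ (i ≡ j) × D ∣ i - j ∣ }

D12 : ℕ → Set
D12 n = (n ≡ 1) ⊎ (n ≡ 2)

data Walk (G : Graph) : V G → V G → ℕ → Set where
  here : ∀ {u} → Walk G u u zero
  step : ∀ {u w v n} → Adj G u w → Walk G w v n → Walk G u v (suc n)

DistLe : (G : Graph) → V G → V G → ℕ → Set
DistLe G u v n = Σ ℕ λ m → m ≤ n × Walk G u v m

-- d_G(u,v) ≥ n + 1 (including d = ∞ for disconnected vertices).
DistGe1+ : (G : Graph) → V G → V G → ℕ → Set
DistGe1+ G u v n = ¬ DistLe G u v n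

IsPackingColoring : (G : Graph) → ℕ → (V G → ℕ) → Set
IsPackingColoring G k f =
  (∀ v → 1 ≤ f v × f v ≤ k) ×
  (∀ u v → ¬ (u ≡ v) → f u ≡ f v → DistGe1+ G u v (f u))

PackingColorable : Graph → ℕ → Set
PackingColorable G k = Σ (V G → ℕ) (IsPackingColoring G k)

PackingChromaticNumberIs : Graph → ℕ → Set
PackingChromaticNumberIs G k =
  PackingColorable G k × (∀ m → PackingColorable G m → k ≤ m)

module Submission where

-- In G = G(ℤ,{1,2}) every edge joins integers at most 2 apart, so a
-- walk of length m moves at most 2m, while u reaches u + d in ⌈d/2⌉ steps.
-- Hence d_G(u,v) ≤ c iff |u - v| ≤ 2c, and a map f : ℤ → ℕ satisfies the
-- packing condition exactly when it is *spread*: two distinct vertices of the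
-- same colour c are more than 2c apart (spread⇒packing, packing⇒spread).
--
-- The 54-periodic colouring read off from an explicit pattern
-- uses the colours 1,…,8 and is spread; by periodicity this reduces to a
-- finite check over one period, decided by evaluation; transporting it to
-- all of ℤ needs the uniqueness of remainders modulo 54.
--
-- A spread colouring with colours 1,…,7 would colour the path
-- 0,1,…,26 so that every new colour c differs from the previous 2c colours.
-- A backtracking search over such colour histories evaluates to false, and
-- its soundness lemma turns any spread 7-colouring into a successful run.

open import Defs
open import Data.Nat
  using (ℕ; zero; suc; _+_; _*_; _≤_; _<_; _≟_; _≤?_; ⌈_/2⌉; NonZero; s≤s; z≤n)
open import Data.Nat.Properties as ℕP
  using (≤-trans; <⇒≱; ≰⇒>; *-monoʳ-≤; +-mono-≤; m≤m+n; ⌈n/2⌉-mono; n≡⌈n+n/2⌉)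
open import Data.Nat.DivMod using (_%_; _mod_; m%n%n≡m%n)
open import Data.Integer as ℤ using (ℤ; +_; -[1+_]; ∣_∣; _-_; -_)
import Data.Integer.Properties as ℤP
open import Data.Integer.DivMod using (_%ℕ_; _/ℕ_; a≡a%ℕn+[a/ℕn]*n; n%ℕd<d)
open import Data.Integer.Tactic.RingSolver using (solve-∀)
open import Data.Bool using (Bool; true; false; _∧_; not; T)
open import Data.Bool.ListAction using (any)
open import Data.Bool.Properties using (T-∧; T-≡)
open import Data.List using (List; []; _∷_; applyUpTo)
open import Data.List.Membership.Propositional using (_∈_; lose)
open import Data.List.Membership.Propositional.Properties using (∈-applyUpTo⁺)
open import Data.List.Relation.Unary.Any.Properties using (any⁺)
open import Data.Vec using (Vec; lookup; []; _∷_)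
open import Data.Fin using (Fin; toℕ; fromℕ<)
open import Data.Fin.Properties using (all?; toℕ-fromℕ<; fromℕ<-cong)
open import Data.Product using (∃; _×_; _,_; proj₁; proj₂)
open import Data.Sum using (_⊎_; inj₁; inj₂)
open import Data.Empty using (⊥; ⊥-elim)
open import Function using (_∘_; Equivalence)
open import Relation.Nullary using (¬_; yes; no; ¬?)
open import Relation.Nullary.Decidable using (⌊_⌋; toWitness; fromWitnessFalse; _×-dec_)
open import Relation.Binary.PropositionalEquality

G : Graph
G = DistanceGraph D12

Packing : (ℤ → ℕ) → Set
Packing f = ∀ u v → ¬ (u ≡ v) → f u ≡ f v → DistGe1+ G u v (f u)

Spread : (ℤ → ℕ) → Set
Spread f = ∀ u k → f (u ℤ.+ + suc k) ≡ f u → 2 * f u < suc k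

Spreadℕ : (ℕ → ℕ) → Set
Spreadℕ h = ∀ i k → h (i + suc k) ≡ h i → 2 * h i < suc k

u-[u+v]≡-v : ∀ u v → u - (u ℤ.+ v) ≡ - v
u-[u+v]≡-v = solve-∀

u-v≡[u-w]+[w-v] : ∀ u v w → u - v ≡ (u - w) ℤ.+ (w - v)
u-v≡[u-w]+[w-v] = solve-∀

v≡u+[v-u] : ∀ u v → v ≡ u ℤ.+ (v - u)
v≡u+[v-u] = solve-∀

u-v≡-[v-u] : ∀ u v → u - v ≡ - (v - u)
u-v≡-[v-u] = solve-∀

[r+qn]-qn : ∀ r q n → r ℤ.+ q ℤ.* n - q ℤ.* n ≡ r
[r+qn]-qn = solve-∀

difference-of-representations : ∀ a b q qa qb n →
  (a ℤ.+ q ℤ.* n - qb ℤ.* n) - (a - qa ℤ.* n) ≡ (qa ℤ.+ q - qb) ℤ.* n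
difference-of-representations = solve-∀

[r+qn]+k : ∀ r q n k → r ℤ.+ q ℤ.* n ℤ.+ k ≡ (r ℤ.+ k) ℤ.+ q ℤ.* n
[r+qn]+k = solve-∀

gap : ∀ u k → ∣ u - (u ℤ.+ + k) ∣ ≡ k
gap u k = begin
  ∣ u - (u ℤ.+ + k) ∣ ≡⟨ cong ∣_∣ (u-[u+v]≡-v u (+ k)) ⟩
  ∣ - + k ∣           ≡⟨ ℤP.∣-i∣≡∣i∣ (+ k) ⟩
  k                   ∎
  where open ≡-Reasoning

u≢u+1+k : ∀ u k → ¬ (u ≡ u ℤ.+ + suc k)
u≢u+1+k u k u≡ = ℕP.0≢1+n (trans (sym ∣u-u∣≡0) ∣u-u∣≡1+k)
  where
  ∣u-u∣≡0 : ∣ u - u ∣ ≡ 0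
  ∣u-u∣≡0 = cong ∣_∣ (ℤP.+-inverseʳ u)
  ∣u-u∣≡1+k : ∣ u - u ∣ ≡ suc k
  ∣u-u∣≡1+k = subst (λ v → ∣ u - v ∣ ≡ suc k) (sym u≡) (gap u (suc k))

adjacent : ∀ u k → D12 (suc k) → Adj G u (u ℤ.+ + suc k)
adjacent u k d = u≢u+1+k u k , subst D12 (sym (gap u (suc k))) d

climb : ∀ u d → Walk G u (u ℤ.+ + d) ⌈ d /2⌉
climb u zero = subst (λ v → Walk G u v 0) (sym (ℤP.+-identityʳ u)) here
climb u (suc zero) = step (adjacent u 0 (inj₁ refl)) here
climb u (suc (suc d)) = step (adjacent u 1 (inj₂ refl)) rest
  where
  rest : Walk G (u ℤ.+ + 2) (u ℤ.+ + suc (suc d)) ⌈ d /2⌉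
  rest = subst (λ v → Walk G (u ℤ.+ + 2) v ⌈ d /2⌉) (ℤP.+-assoc u (+ 2) (+ d)) (climb (u ℤ.+ + 2) d)

walk-span : ∀ {u v m} → Walk G u v m → ∣ u - v ∣ ≤ 2 * m
walk-span {u} here = ℕP.≤-reflexive (cong ∣_∣ (ℤP.+-inverseʳ u))
walk-span {u} {v} {suc m} (step {w = w} (_ , edge) walk) = begin
  ∣ u - v ∣                 ≡⟨ cong ∣_∣ (u-v≡[u-w]+[w-v] u v w) ⟩
  ∣ (u - w) ℤ.+ (w - v) ∣   ≤⟨ ℤP.∣i+j∣≤∣i∣+∣j∣ (u - w) (w - v) ⟩
  ∣ u - w ∣ + ∣ w - v ∣     ≤⟨ +-mono-≤ (edge≤2 edge) (walk-span walk) ⟩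
  2 + 2 * m                 ≡⟨ ℕP.*-suc 2 m ⟨
  2 * suc m                 ∎
  where
  open ℕP.≤-Reasoning
  edge≤2 : ∀ {n} → D12 n → n ≤ 2
  edge≤2 (inj₁ refl) = s≤s z≤n
  edge≤2 (inj₂ refl) = s≤s (s≤s z≤n)

distLe⇒near : ∀ {u v c} → DistLe G u v c → ∣ u - v ∣ ≤ 2 * c
distLe⇒near (m , m≤c , walk) = ≤-trans (walk-span walk) (*-monoʳ-≤ 2 m≤c)

near⇒distLe : ∀ u d c → d ≤ 2 * c → DistLe G u (u ℤ.+ + d) c
near⇒distLe u d c d≤2c = ⌈ d /2⌉ , ⌈d/2⌉≤c , climb u d
  where
  ⌈2c/2⌉≡c : ⌈ 2 * c /2⌉ ≡ c
  ⌈2c/2⌉≡c = sym (trans (n≡⌈n+n/2⌉ c) (cong (λ m → ⌈ c + m /2⌉) (sym (ℕP.+-identityʳ c))))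
  ⌈d/2⌉≤c : ⌈ d /2⌉ ≤ c
  ⌈d/2⌉≤c = subst (⌈ d /2⌉ ≤_) ⌈2c/2⌉≡c (⌈n/2⌉-mono d≤2c)

apart : ∀ u v → ¬ (u ≡ v) → ∃ λ k → v ≡ u ℤ.+ + suc k ⊎ u ≡ v ℤ.+ + suc k
apart u v u≢v with v - u in v-u≡
... | + zero   = ⊥-elim (u≢v (sym (ℤP.i-j≡0⇒i≡j v u v-u≡)))
... | + suc k  = k , inj₁ (trans (v≡u+[v-u] u v) (cong (λ w → u ℤ.+ w) v-u≡))
... | -[1+ k ] = k , inj₂ (trans (v≡u+[v-u] v u) (cong (λ w → v ℤ.+ w) u-v≡))
  where
  u-v≡ : u - v ≡ + suc k
  u-v≡ = trans (u-v≡-[v-u] u v) (cong -_ v-u≡)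

spread⇒packing : ∀ {f} → Spread f → Packing f
spread⇒packing {f} spread u v u≢v fu≡fv close with apart u v u≢v
... | k , inj₁ refl = <⇒≱ (spread u k (sym fu≡fv))
        (subst (_≤ 2 * f u) (gap u (suc k)) (distLe⇒near close))
... | k , inj₂ refl = <⇒≱ (spread v k fu≡fv)
        (subst₂ _≤_ (trans (ℤP.∣i-j∣≡∣j-i∣ (v ℤ.+ + suc k) v) (gap v (suc k)))
                    (cong (2 *_) fu≡fv) (distLe⇒near close))

packing⇒spread : ∀ {f} → Packing f → Spread f
packing⇒spread {f} packing u k same = ≰⇒> λ near →
  packing u (u ℤ.+ + suc k) (u≢u+1+k u k) (sym same) (near⇒distLe u (suc k) (f u) near)

multiple<⇒0 : ∀ m n → m * n < n → m ≡ 0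
multiple<⇒0 zero    n _   = refl
multiple<⇒0 (suc m) n m*n<n = ⊥-elim (<⇒≱ m*n<n (m≤m+n n (m * n)))

remainder-unique : ∀ {n} r s x → r < n → s < n → + r - + s ≡ x ℤ.* + n → r ≡ s
remainder-unique {n} r s x r<n s<n r-s≡xn = ℤP.+-injective (ℤP.i-j≡0⇒i≡j (+ r) (+ s) r-s≡0)
  where
  ∣r-s∣<n : ∣ + r - + s ∣ < n
  ∣r-s∣<n = subst (_< n) (cong ∣_∣ (sym (ℤP.m-n≡m⊖n r s)))
              (ℕP.≤-<-trans (ℤP.∣m⊝n∣≤m⊔n r s) (ℕP.⊔-lub r<n s<n))
  ∣r-s∣≡∣x∣*n : ∣ + r - + s ∣ ≡ ∣ x ∣ * n
  ∣r-s∣≡∣x∣*n = trans (cong ∣_∣ r-s≡xn) (ℤP.abs-* x (+ n))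
  ∣x∣≡0 : ∣ x ∣ ≡ 0
  ∣x∣≡0 = multiple<⇒0 ∣ x ∣ n (subst (_< n) ∣r-s∣≡∣x∣*n ∣r-s∣<n)
  r-s≡0 : + r - + s ≡ + 0
  r-s≡0 = trans r-s≡xn (cong (ℤ._* + n) (ℤP.∣i∣≡0⇒i≡0 {i = x} ∣x∣≡0))

%ℕ-+-multiple : ∀ {n} .{{_ : NonZero n}} a q → (a ℤ.+ q ℤ.* + n) %ℕ n ≡ a %ℕ n
%ℕ-+-multiple {n} a q = remainder-unique _ _ (qa ℤ.+ q - qb) (n%ℕd<d b n) (n%ℕd<d a n) rb-ra≡
  where
  b = a ℤ.+ q ℤ.* + n
  qa = a /ℕ n
  qb = b /ℕ n
  rb-ra≡ : + (b %ℕ n) - + (a %ℕ n) ≡ (qa ℤ.+ q - qb) ℤ.* + n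
  rb-ra≡ = begin
    + (b %ℕ n) - + (a %ℕ n)
      ≡⟨ cong₂ _-_ (sym ([r+qn]-qn (+ (b %ℕ n)) qb (+ n))) (sym ([r+qn]-qn (+ (a %ℕ n)) qa (+ n))) ⟩
    (+ (b %ℕ n) ℤ.+ qb ℤ.* + n - qb ℤ.* + n) - (+ (a %ℕ n) ℤ.+ qa ℤ.* + n - qa ℤ.* + n)
      ≡⟨ cong₂ (λ x y → (x - qb ℤ.* + n) - (y - qa ℤ.* + n))
               (sym (a≡a%ℕn+[a/ℕn]*n b n)) (sym (a≡a%ℕn+[a/ℕn]*n a n)) ⟩
    (b - qb ℤ.* + n) - (a - qa ℤ.* + n)
      ≡⟨ difference-of-representations a b q qa qb (+ n) ⟩
    (qa ℤ.+ q - qb) ℤ.* + n ∎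
    where open ≡-Reasoning

%ℕ-shift : ∀ {n} .{{_ : NonZero n}} u k → (u ℤ.+ + k) %ℕ n ≡ (u %ℕ n + k) % n
%ℕ-shift {n} u k = begin
  (u ℤ.+ + k) %ℕ n
    ≡⟨ cong (λ a → (a ℤ.+ + k) %ℕ n) (a≡a%ℕn+[a/ℕn]*n u n) ⟩
  (+ (u %ℕ n) ℤ.+ q ℤ.* + n ℤ.+ + k) %ℕ n
    ≡⟨ cong (_%ℕ n) ([r+qn]+k (+ (u %ℕ n)) q (+ n) (+ k)) ⟩
  (+ (u %ℕ n + k) ℤ.+ q ℤ.* + n) %ℕ n
    ≡⟨ %ℕ-+-multiple (+ (u %ℕ n + k)) q ⟩
  (u %ℕ n + k) % n ∎
  where
  q = u /ℕ n
  open ≡-Reasoning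

period : Vec ℕ 54
period = 1 ∷ 8 ∷ 3 ∷ 1 ∷ 2 ∷ 4 ∷ 1 ∷ 5 ∷ 7 ∷ 1 ∷ 3 ∷ 2 ∷ 1 ∷ 6 ∷ 4 ∷ 1 ∷ 2 ∷ 3
       ∷ 1 ∷ 8 ∷ 5 ∷ 1 ∷ 2 ∷ 4 ∷ 1 ∷ 3 ∷ 6 ∷ 1 ∷ 2 ∷ 7 ∷ 1 ∷ 5 ∷ 4 ∷ 2 ∷ 1 ∷ 3
       ∷ 8 ∷ 1 ∷ 2 ∷ 6 ∷ 1 ∷ 4 ∷ 3 ∷ 2 ∷ 1 ∷ 5 ∷ 7 ∷ 1 ∷ 2 ∷ 3 ∷ 4 ∷ 1 ∷ 6 ∷ 2 ∷ []

periodic : ℕ → ℕ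
periodic r = lookup period (r mod 54)

colouring : ℤ → ℕ
colouring u = periodic (u %ℕ 54)

periodic-% : ∀ r → periodic (r % 54) ≡ periodic r
periodic-% r = cong (lookup period) (fromℕ<-cong _ _ (m%n%n≡m%n r 54) _ _)

period-range : ∀ i → 1 ≤ lookup period i × lookup period i ≤ 8
period-range = toWitness {a? = all? λ i → (1 ≤? lookup period i) ×-dec (lookup period i ≤? 8)} _

period-spread : ∀ (i : Fin 54) (k : Fin (2 * periodic (toℕ i))) →
                ¬ (periodic (toℕ i + suc (toℕ k)) ≡ periodic (toℕ i))
period-spread = toWitness {a? = all? λ i → all? λ k →
  ¬? (periodic (toℕ i + suc (toℕ k)) ≟ periodic (toℕ i))} _

colouring-range : ∀ u → 1 ≤ colouring u × colouring u ≤ 8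
colouring-range u = period-range ((u %ℕ 54) mod 54)

periodic-spread : ∀ r k → r < 54 → k < 2 * periodic r →
                  ¬ (periodic (r + suc k) ≡ periodic r)
periodic-spread r k r<54 = subst (λ j → k < 2 * periodic j → ¬ (periodic (j + suc k) ≡ periodic j))
                                 (toℕ-fromℕ< r<54) (from-period (fromℕ< r<54))
  where
  from-period : ∀ i → k < 2 * periodic (toℕ i) → ¬ (periodic (toℕ i + suc k) ≡ periodic (toℕ i))
  from-period i k<2c = subst (λ j → ¬ (periodic (toℕ i + suc j) ≡ periodic (toℕ i)))
                             (toℕ-fromℕ< k<2c) (period-spread i (fromℕ< k<2c))

colouring-spread : Spread colouring
colouring-spread u k same = ≰⇒> λ near → periodic-spread r k (n%ℕd<d u 54) near recur
  where
  r = u %ℕ 54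
  recur : periodic (r + suc k) ≡ periodic r
  recur = begin
    periodic (r + suc k)        ≡⟨ periodic-% (r + suc k) ⟨
    periodic ((r + suc k) % 54) ≡⟨ cong periodic (%ℕ-shift u (suc k)) ⟨
    colouring (u ℤ.+ + suc k)   ≡⟨ same ⟩
    colouring u                 ∎
    where open ≡-Reasoning

-- A colour history lists the colours of the positions j-1, j-2, …, 0 of a
-- path, most recent first.  'fresh c m s': colour c is absent from the m
-- most recent entries of s.
fresh : ℕ → ℕ → List ℕ → Bool
fresh c zero    s       = true
fresh c (suc m) []      = true
fresh c (suc m) (x ∷ s) = not ⌊ x ≟ c ⌋ ∧ fresh c m s

extendable : ℕ → ℕ → List ℕ → Bool
extendable k zero    s = true
extendable k (suc n) s =
  any (λ c → fresh c (2 * c) s ∧ extendable k n (c ∷ s)) (applyUpTo suc k)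

no-extension : extendable 7 27 [] ≡ false
no-extension = refl

module Search {k} (h : ℕ → ℕ) (range : ∀ i → 1 ≤ h i × h i ≤ k) (spread : Spreadℕ h) where

  history : ℕ → List ℕ
  history zero    = []
  history (suc j) = h j ∷ history j

  fresh-history : ∀ c m j → (∀ i d → i + suc d ≡ j → suc d ≤ m → ¬ (h i ≡ c)) →
                  T (fresh c m (history j))
  fresh-history c zero    j       absent = _
  fresh-history c (suc m) zero    absent = _
  fresh-history c (suc m) (suc j) absent = Equivalence.from T-∧ (latest , earlier)
    where
    latest : T (not ⌊ h j ≟ c ⌋)
    latest = fromWitnessFalse (absent j 0 (ℕP.+-comm j 1) (s≤s z≤n))
    earlier : T (fresh c m (history j))
    earlier = fresh-history c m j λ i d i+1+d≡j 1+d≤m →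
      absent i (suc d) (trans (ℕP.+-suc i (suc d)) (cong suc i+1+d≡j)) (s≤s 1+d≤m)

  separated : ∀ i d j → i + suc d ≡ j → suc d ≤ 2 * h j → ¬ (h i ≡ h j)
  separated i d _ refl near same = <⇒≱ (spread i d (sym same)) (subst (λ c → suc d ≤ 2 * c) (sym same) near)

  in-palette : ∀ c → 1 ≤ c → c ≤ k → c ∈ applyUpTo suc k
  in-palette (suc c) _ c<k = ∈-applyUpTo⁺ suc c<k

  history-extendable : ∀ n j → T (extendable k n (history j))
  history-extendable zero    j = _
  history-extendable (suc n) j =
    any⁺ _ (lose (in-palette (h j) (proj₁ (range j)) (proj₂ (range j))) (Equivalence.from T-∧
      (fresh-history (h j) (2 * h j) j (λ i d → separated i d j) , history-extendable n (suc j))))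

  search-succeeds : ∀ n → extendable k n [] ≡ true
  search-succeeds n = Equivalence.to T-≡ (history-extendable n 0)

no-spread-7-colouring : ∀ h → (∀ i → 1 ≤ h i × h i ≤ 7) → Spreadℕ h → ⊥
no-spread-7-colouring h range spread =
  true≢false (trans (sym (Search.search-succeeds h range spread 27)) no-extension)
  where
  true≢false : ¬ (true ≡ false)
  true≢false ()

spread-needs-8 : ∀ k f → (∀ v → 1 ≤ f v × f v ≤ k) → Spread f → 8 ≤ k
spread-needs-8 k f range spread with 8 ≤? k
... | yes 8≤k = 8≤k
... | no 8≰k  = ⊥-elim (no-spread-7-colouring (f ∘ +_) range₇ (spread ∘ +_))
  where
  range₇ : ∀ i → 1 ≤ f (+ i) × f (+ i) ≤ 7
  range₇ i = proj₁ (range (+ i)) , ≤-trans (proj₂ (range (+ i))) (ℕP.≤-pred (≰⇒> 8≰k))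

proposition3 : PackingChromaticNumberIs (DistanceGraph D12) 8
proposition3 = (colouring , colouring-range , spread⇒packing colouring-spread) , lower-bound
  where
  lower-bound : ∀ m → PackingColorable (DistanceGraph D12) m → 8 ≤ m
  lower-bound m (f , range , packing) = spread-needs-8 m f range (packing⇒spread packing)
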